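{- Let $G$ be a cactus graph and let $S\subseteq V(G)$. If $S$ is a vertex metric generator (resp. an edge metric generator) of $G$, then $S$ is a biactive branch-resolving set.
   Context: All graphs are finite, simple and connected; $d(u,v)$ denotes the distance between vertices $u,v$, and for a vertex $u$ and an edge $vw$, $d(u,vw)=\min\{d(u,v),d(u,w)\}$. A vertex $s$ distinguishes two vertices (resp. two edges) $x,x'$ if $d(s,x)\neq d(s,x')$. A set $S\subseteq V(G)$ is a vertex (resp. edge) metric generator if every pair of distinct vertices (resp. distinct edges) of $G$ is distinguished by some vertex of $S$. A cactus graph is a connected graph in which all cycles are pairwise edge-disjoint. A thread hanging at a vertex $v$ of degree $\geq 3$ is a path $u_1u_2\cdots u_k$ ($k\ge1$) such that $u_1$ is a leaf, $u_2,\dots,u_k$ have degree $2$, and $u_k$ is adjacent to $v$. A thread is $S$-free if it contains no vertex of $S$. $S$ is branch-resolving if at every vertex of degree $\ge 3$ at most one $S$-free thread hangs. For a cycle $C$ of $G$ and $v\in V(C)$, $T_v(C)$ is the connected component of $G-E(C)$ containing $v$; $v$ is $S$-active on $C$ if $T_v(C)$ contains a vertex of $S$, and $a_S(C)$ is the number of $S$-active vertices on $C$. $S$ is biactive if $a_S(C)\ge 2$ for every cycle $C$ of $G$. -}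

module Defs where

open import Data.Nat using (ℕ; zero; suc; _≤_; _<_; _⊓_)
open import Data.Fin using (Fin; zero; suc; inject₁; fromℕ)
open import Data.Fin.Subset using (Subset; _∈_; _∉_; ∣_∣)
open import Data.Vec using (tabulate)
open import Data.Bool using (Bool; true; false)
open import Data.Product using (Σ; ∃; ∃-syntax; _×_; _,_)
open import Data.Sum using (_⊎_)
open import Relation.Nullary using (¬_)
open import Relation.Binary.PropositionalEquality using (_≡_; _≢_)

record Graph : Set where
  field
    n     : ℕ
    nonempty : 1 ≤ n
    adj   : Fin n → Fin n → Bool
    sym   : ∀ u v → adj u v ≡ adj v u
    irrefl : ∀ v → adj v v ≡ false

module _ (G : Graph) where
  open Graph G

  V : Set
  V = Fin n

  Adj : V → V → Set
  Adj u v = adj u v ≡ true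

  deg : V → ℕ
  deg v = ∣ tabulate (adj v) ∣

  data Walk (E : V → V → Set) : V → V → ℕ → Set where
    here : ∀ {u} → Walk E u u 0
    step : ∀ {u w v k} → E u w → Walk E w v k → Walk E u v (suc k)

  Connected : Set
  Connected = ∀ u v → ∃[ k ] Walk Adj u v k

  Dist : V → V → ℕ → Set
  Dist u v k = Walk Adj u v k × (∀ j → j < k → ¬ Walk Adj u v j)

  EDist : V → V → V → ℕ → Set
  EDist u v w k = ∃[ a ] ∃[ b ] (Dist u v a × Dist u w b × k ≡ a ⊓ b)

  DistinguishesV : V → V → V → Set
  DistinguishesV s x x' = ∀ a b → Dist s x a → Dist s x' b → a ≢ b

  DistinguishesE : V → V → V → V → V → Set
  DistinguishesE s v w v' w' = ∀ a b → EDist s v w a → EDist s v' w' b → a ≢ b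

  SameEdge : V → V → V → V → Set
  SameEdge v w v' w' = (v ≡ v' × w ≡ w') ⊎ (v ≡ w' × w ≡ v')

  VertexMetricGenerator : Subset n → Set
  VertexMetricGenerator S =
    ∀ x x' → x ≢ x' → ∃[ s ] (s ∈ S × DistinguishesV s x x')

  EdgeMetricGenerator : Subset n → Set
  EdgeMetricGenerator S =
    ∀ v w v' w' → Adj v w → Adj v' w' → ¬ SameEdge v w v' w' →
    ∃[ s ] (s ∈ S × DistinguishesE s v w v' w')

  -- Cycles: vtx 0, vtx 1, …, vtx m, back to vtx 0 (length m+1 ≥ 3)

  record Cycle : Set where
    field
      m     : ℕ
      long  : 2 ≤ m
      vtx   : Fin (suc m) → V
      inj   : ∀ i j → vtx i ≡ vtx j → i ≡ j
      adjs  : ∀ (i : Fin m) → Adj (vtx (inject₁ i)) (vtx (suc i))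
      close : Adj (vtx (fromℕ m)) (vtx zero)

  CycEdge : Cycle → V → V → Set
  CycEdge C u v =
    (∃[ i ] SameEdge u v (vtx (inject₁ i)) (vtx (suc i)))
    ⊎ SameEdge u v (vtx (fromℕ m)) (vtx zero)
    where open Cycle C

  -- cactus: cycles sharing an edge have the same edge set (i.e. are equal)
  Cactus : Set
  Cactus = ∀ (C C' : Cycle) u v → CycEdge C u v → CycEdge C' u v →
           ∀ x y → (CycEdge C x y → CycEdge C' x y) × (CycEdge C' x y → CycEdge C x y)

  -- vertex vtx i of C is S-active: T_v(C) (component of G − E(C) containing v)
  -- contains a vertex of S
  Active : Subset n → (C : Cycle) → Fin (suc (Cycle.m C)) → Set
  Active S C i = ∃[ s ] (s ∈ S × ∃[ k ]
    Walk (λ a b → Adj a b × ¬ CycEdge C a b) (Cycle.vtx C i) s k)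

  Biactive : Subset n → Set
  Biactive S = ∀ (C : Cycle) → ∃[ i ] ∃[ j ] (i ≢ j × Active S C i × Active S C j)

  record Thread (v : V) : Set where
    field
      m     : ℕ
      vtx   : Fin (suc m) → V
      inj   : ∀ i j → vtx i ≡ vtx j → i ≡ j
      adjs  : ∀ (i : Fin m) → Adj (vtx (inject₁ i)) (vtx (suc i))
      leaf  : deg (vtx zero) ≡ 1
      deg2  : ∀ (i : Fin m) → deg (vtx (suc i)) ≡ 2
      hang  : Adj (vtx (fromℕ m)) v

  OnThread : ∀ {v} → Thread v → V → Set
  OnThread T x = ∃[ i ] (Thread.vtx T i ≡ x)

  SFree : ∀ {v} → Subset n → Thread v → Set
  SFree S T = ∀ i → Thread.vtx T i ∉ S

  -- at every vertex of degree ≥ 3 at most one S-free thread hangs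
  BranchResolving : Subset n → Set
  BranchResolving S = ∀ v → 3 ≤ deg v → (T T' : Thread v) → SFree S T → SFree S T' →
    ∀ x → (OnThread T x → OnThread T' x) × (OnThread T' x → OnThread T x)

{-# OPTIONS --safe #-}
module Submission where

-- Both properties come from one observation: if every walk from s to the neighbours x₁ ≠ x₂
-- of v passes through v, then d(s,x₁) = d(s,x₂) = d(s,v) + 1 and d(s,vx₁) = d(s,vx₂) = d(s,v),
-- so s distinguishes neither the vertices x₁, x₂ nor the edges vx₁, vx₂.
--
-- If two S-free threads hung at v with different last vertices x₁, x₂, every s ∈ S would
-- reach x₁ and x₂ only through v. So S-free threads at v share their last vertex, and then
-- they coincide: a thread consists of the vertices reachable from its last vertex avoiding v.
--
-- In a cactus, distinct vertices of a cycle C lie in distinct components of G − E(C):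
-- otherwise the first return to C of a connecting walk is an ear of C which, glued to an arc
-- of C, forms a second cycle sharing an edge with C. Hence if S ⊆ T_c(C), every s ∈ S reaches
-- the two cycle-neighbours of c only through c. So for every vertex c of C some other vertex
-- of C is S-active, and applying this twice yields two of them.

open import Defs
open import Data.Nat using (ℕ; zero; suc; z<s; z≤n; s≤s; _+_; _∸_; _≤_; _<_; _≟_; _<?_; _≤?_)
open import Data.Nat.Properties
  using (≤-refl; ≤-trans; ≤-reflexive; ≤-antisym; <-≤-trans; <⇒≤; <⇒≢; <⇒≱; ≮⇒≥; ≰⇒>; ≤∧≢⇒<;
         n<1+n; n≤1+n; m≤n⇒m≤1+n; m<n⇒m<1+n; m<1+n⇒m≤n; m<1+n⇒m<n∨m≡n; n≢0⇒n>0; m<m+n; m≤n+m;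
         <-cmp; m≤n⇒∃[o]m+o≡n; +-suc; +-identityʳ; +-cancelˡ-≡; +-cancelˡ-≤; +-monoʳ-≤;
         m+[n∸m]≡n; +-∸-assoc; m+n∸n≡m; m+n∸m≡n; m∸n≤m; ∸-cancelˡ-≡; anyUpTo?)
open import Data.Fin using (Fin; zero; suc; toℕ; fromℕ; fromℕ<; inject₁)
open import Data.Fin.Properties
  using (any?; toℕ-injective; toℕ-inject₁; toℕ-fromℕ; toℕ-fromℕ<; toℕ<n; fromℕ<-toℕ; fromℕ<-injective)
  renaming (_≟_ to _≟ᶠ_)
open import Data.Fin.Induction using (>-weakInduction)
open import Data.Fin.Relation.Unary.Top using (view; ‵fromℕ; ‵inject₁)
open import Data.Fin.Subset using (Subset; _∈_; ∣_∣)
open import Data.Fin.Subset.Properties using (x∈p⇒∣p-x∣<∣p∣; x∈p∧x≢y⇒x∈p-y)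
open import Data.Vec using (tabulate)
open import Data.Vec.Properties using (lookup⇒[]=; lookup∘tabulate)
open import Data.Bool using (true)
open import Data.Bool.Properties using () renaming (_≟_ to _≟ᵇ_)
open import Data.Product using (∃-syntax; _×_; _,_; proj₁; proj₂)
open import Data.Sum using (_⊎_; inj₁; inj₂; [_,_])
open import Data.Empty using (⊥; ⊥-elim)
open import Function using (_∘_)
open import Relation.Nullary using (¬_; Dec; yes; no; _×-dec_; _⊎-dec_)
open import Relation.Binary using (tri<; tri≈; tri>)
open import Relation.Binary.PropositionalEquality using (_≡_; _≢_; refl; sym; trans; cong; subst; subst₂)

∈⇒1≤∣p∣ : ∀ {n} {p : Subset n} {x} → x ∈ p → 1 ≤ ∣ p ∣
∈⇒1≤∣p∣ x∈p = ≤-trans (s≤s z≤n) (x∈p⇒∣p-x∣<∣p∣ x∈p)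

∈₂⇒2≤∣p∣ : ∀ {n} {p : Subset n} {x y} → x ∈ p → y ∈ p → x ≢ y → 2 ≤ ∣ p ∣
∈₂⇒2≤∣p∣ x∈p y∈p x≢y =
  ≤-trans (s≤s (∈⇒1≤∣p∣ (x∈p∧x≢y⇒x∈p-y y∈p (x≢y ∘ sym)))) (x∈p⇒∣p-x∣<∣p∣ x∈p)

∈₃⇒3≤∣p∣ : ∀ {n} {p : Subset n} {x y z} → x ∈ p → y ∈ p → z ∈ p →
           x ≢ y → x ≢ z → y ≢ z → 3 ≤ ∣ p ∣
∈₃⇒3≤∣p∣ x∈p y∈p z∈p x≢y x≢z y≢z =
  ≤-trans (s≤s (∈₂⇒2≤∣p∣ (x∈p∧x≢y⇒x∈p-y y∈p (x≢y ∘ sym)) (x∈p∧x≢y⇒x∈p-y z∈p (x≢z ∘ sym)) y≢z))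
    (x∈p⇒∣p-x∣<∣p∣ x∈p)

module _ {P : ℕ → Set} (P? : ∀ k → Dec (P k)) where

  private
    search : ∀ n → (∀ i → i < n → ¬ P i) ⊎ ∃[ j ] (P j × (∀ i → i < j → ¬ P i))
    search zero = inj₁ λ _ ()
    search (suc n) with search n | P? n
    ... | inj₂ least | _      = inj₂ least
    ... | inj₁ none  | yes Pn = inj₂ (n , Pn , none)
    ... | inj₁ none  | no ¬Pn =
      inj₁ λ i i<1+n → [ none i , (λ { refl → ¬Pn }) ] (m<1+n⇒m<n∨m≡n i<1+n)

  least-witness : ∀ k → P k → ∃[ j ] (P j × (∀ i → i < j → ¬ P i))
  least-witness k Pk with search (suc k)
  ... | inj₁ none  = ⊥-elim (none k ≤-refl Pk)
  ... | inj₂ least = least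

-- Walks, distances and degrees

module Walks (G : Graph) where
  open Graph G using (adj; irrefl)

  adj-sym : ∀ {a b} → Adj G a b → Adj G b a
  adj-sym {a} {b} e = trans (Graph.sym G b a) e

  adj-irrefl : ∀ {a b} → Adj G a b → a ≢ b
  adj-irrefl {a} e refl with trans (sym (irrefl a)) e
  ... | ()

  adj? : ∀ a b → Dec (Adj G a b)
  adj? a b = adj a b ≟ᵇ true

  snoc : ∀ {E u w v k} → Walk G E u w k → E w v → Walk G E u v (suc k)
  snoc here       e′ = step e′ here
  snoc (step e w) e′ = step e (snoc w e′)

  reverse : ∀ {E u v k} → (∀ {a b} → E a b → E b a) → Walk G E u v k → Walk G E v u k
  reverse E-sym here       = here
  reverse E-sym (step e w) = snoc (reverse E-sym w) (E-sym e)

  walk? : ∀ {E} → (∀ a b → Dec (E a b)) → ∀ k u v → Dec (Walk G E u v k)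
  walk? E? zero u v with u ≟ᶠ v
  ... | yes refl = yes here
  ... | no  u≢v  = no λ { here → u≢v refl }
  walk? {E} E? (suc k) u v with any? first-step?
    where
    first-step? : ∀ w → Dec (E u w × Walk G E w v k)
    first-step? w with E? u w | walk? E? k w v
    ... | yes e  | yes r  = yes (e , r)
    ... | no ¬e  | _      = no (¬e ∘ proj₁)
    ... | _      | no ¬r  = no (¬r ∘ proj₂)
  ... | yes (w , e , r) = yes (step e r)
  ... | no  ¬first      = no λ { (step e r) → ¬first (_ , e , r) }

  dist-exists : Connected G → ∀ u v → ∃[ d ] Dist G u v d
  dist-exists conn u v = least-witness (λ j → walk? adj? j u v) (proj₁ (conn u v)) (proj₂ (conn u v))

  dist≤length : ∀ {u v d j} → Dist G u v d → Walk G (Adj G) u v j → d ≤ j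
  dist≤length {d = d} {j} (_ , shortest) w with j <? d
  ... | yes j<d = ⊥-elim (shortest j j<d w)
  ... | no  j≮d = ≮⇒≥ j≮d

  Adj-avoiding : V G → V G → V G → Set
  Adj-avoiding v a b = Adj G a b × b ≢ v

  Gated : V G → V G → V G → Set
  Gated s v x = ∀ {k} → Walk G (Adj G) s x k → ∃[ j ] (j < k × Walk G (Adj G) s v j)

  gated-dist : ∀ {s v x d} → Dist G s v d → Adj G v x → Gated s v x → Dist G s x (suc d)
  gated-dist D@(w , _) e gated = snoc w e , shortest
    where
    shortest : ∀ j → j < suc _ → ¬ Walk G (Adj G) _ _ j
    shortest j j<1+d wj with gated wj
    ... | i , i<j , wi = <⇒≱ (<-≤-trans i<j (m<1+n⇒m≤n j<1+d)) (dist≤length D wi)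

  sameEdge-swap : ∀ {u w a b} → SameEdge G u w a b → SameEdge G w u a b
  sameEdge-swap (inj₁ (u≡a , w≡b)) = inj₂ (w≡b , u≡a)
  sameEdge-swap (inj₂ (u≡b , w≡a)) = inj₁ (w≡a , u≡b)

  sameEdge? : ∀ u w a b → Dec (SameEdge G u w a b)
  sameEdge? u w a b = (u ≟ᶠ a ×-dec w ≟ᶠ b) ⊎-dec (u ≟ᶠ b ×-dec w ≟ᶠ a)

  distinct-edges-at : ∀ {v x₁ x₂} → Adj G v x₂ → x₁ ≢ x₂ → ¬ SameEdge G v x₁ v x₂
  distinct-edges-at e₂ x₁≢x₂ (inj₁ (_ , x₁≡x₂)) = x₁≢x₂ x₁≡x₂
  distinct-edges-at e₂ x₁≢x₂ (inj₂ (v≡x₂ , _))  = adj-irrefl e₂ v≡x₂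

  generator-escapes-gate : Connected G → ∀ {S v x₁ x₂} → Adj G v x₁ → Adj G v x₂ → x₁ ≢ x₂ →
    VertexMetricGenerator G S ⊎ EdgeMetricGenerator G S →
    ∃[ s ] (s ∈ S × ¬ (Gated s v x₁ × Gated s v x₂))
  generator-escapes-gate conn {v = v} e₁ e₂ x₁≢x₂ (inj₁ resolving) with resolving _ _ x₁≢x₂
  ... | s , s∈S , distinguishes = s , s∈S , λ (g₁ , g₂) →
    let (d , D) = dist-exists conn s v in
    distinguishes _ _ (gated-dist D e₁ g₁) (gated-dist D e₂ g₂) refl
  generator-escapes-gate conn {v = v} e₁ e₂ x₁≢x₂ (inj₂ resolving)
    with resolving _ _ _ _ e₁ e₂ (distinct-edges-at e₂ x₁≢x₂)
  ... | s , s∈S , distinguishes = s , s∈S , λ (g₁ , g₂) →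
    let (d , D) = dist-exists conn s v in
    distinguishes _ _ (d , suc d , D , gated-dist D e₁ g₁ , refl)
                      (d , suc d , D , gated-dist D e₂ g₂ , refl) refl

  ∈-neighbours : ∀ {u a} → Adj G u a → a ∈ tabulate (adj u)
  ∈-neighbours {u} {a} e = lookup⇒[]= a _ (trans (lookup∘tabulate (adj u) a) e)

  deg≡1⇒neighbour-unique : ∀ {u a b} → deg G u ≡ 1 → Adj G u a → Adj G u b → a ≡ b
  deg≡1⇒neighbour-unique {a = a} {b} d≡1 ea eb with a ≟ᶠ b
  ... | yes a≡b = a≡b
  ... | no  a≢b = ⊥-elim (<⇒≱ (∈₂⇒2≤∣p∣ (∈-neighbours ea) (∈-neighbours eb) a≢b) (≤-reflexive d≡1))

  deg≡2⇒neighbours : ∀ {u a b c} → deg G u ≡ 2 → Adj G u a → Adj G u b → a ≢ b →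
                     Adj G u c → c ≡ a ⊎ c ≡ b
  deg≡2⇒neighbours {a = a} {b} {c} d≡2 ea eb a≢b ec with c ≟ᶠ a | c ≟ᶠ b
  ... | yes c≡a | _       = inj₁ c≡a
  ... | no  _   | yes c≡b = inj₂ c≡b
  ... | no  c≢a | no  c≢b = ⊥-elim (<⇒≱ (∈₃⇒3≤∣p∣ (∈-neighbours ea) (∈-neighbours eb) (∈-neighbours ec)
                                                  a≢b (c≢a ∘ sym) (c≢b ∘ sym))
                                        (≤-reflexive d≡2))

-- Threads

module ThreadStructure (G : Graph) {v : V G} (3≤deg : 3 ≤ deg G v) (T : Thread G v) where
  open Walks G
  open Thread T

  top : V G
  top = vtx (fromℕ m)

  deg≤2 : ∀ i → deg G (vtx i) ≤ 2
  deg≤2 zero    = ≤-trans (≤-reflexive leaf) (s≤s z≤n)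
  deg≤2 (suc i) = ≤-reflexive (deg2 i)

  vtx≢v : ∀ i → vtx i ≢ v
  vtx≢v i vtx≡v = <⇒≱ 3≤deg (subst (λ x → deg G x ≤ 2) vtx≡v (deg≤2 i))

  Above : Fin (suc m) → V G → Set
  Above i u = u ≡ v ⊎ ∃[ j ] (toℕ j ≡ suc (toℕ i) × vtx j ≡ u)

  upper-neighbour : ∀ i → ∃[ u ] (Adj G (vtx i) u × Above i u)
  upper-neighbour i with view i
  ... | ‵fromℕ     = v , hang , inj₁ refl
  ... | ‵inject₁ j = vtx (suc j) , adjs j , inj₂ (suc j , cong suc (sym (toℕ-inject₁ j)) , refl)

  lower≢upper : ∀ k {u} → Above (suc k) u → vtx (inject₁ k) ≢ u
  lower≢upper k (inj₁ refl)                  = vtx≢v (inject₁ k)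
  lower≢upper k (inj₂ (j , j≡2+k , refl)) eq =
    <⇒≢ (m<n⇒m<1+n (n<1+n (toℕ k))) (trans (sym (toℕ-inject₁ k)) (trans (cong toℕ (inj _ _ eq)) j≡2+k))

  above⇒v-or-on-thread : ∀ {i u} → Above i u → u ≡ v ⊎ OnThread G T u
  above⇒v-or-on-thread (inj₁ u≡v)           = inj₁ u≡v
  above⇒v-or-on-thread (inj₂ (j , _ , vtx≡u)) = inj₂ (j , vtx≡u)

  neighbour : ∀ i {b} → Adj G (vtx i) b → b ≡ v ⊎ OnThread G T b
  neighbour i e with upper-neighbour i
  neighbour zero e | u , eu , above
    rewrite deg≡1⇒neighbour-unique leaf e eu = above⇒v-or-on-thread above
  neighbour (suc k) e | u , eu , above
    with deg≡2⇒neighbours (deg2 k) (adj-sym (adjs k)) eu (lower≢upper k above) e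
  ... | inj₁ refl = inj₂ (inject₁ k , refl)
  ... | inj₂ refl = above⇒v-or-on-thread above

  entry-through-v : ∀ {u y k} → ¬ OnThread G T u → OnThread G T y → Walk G (Adj G) u y k →
                    ∃[ j ] (j < k × Walk G (Adj G) u v j)
  entry-through-v u∉T y∈T here = ⊥-elim (u∉T y∈T)
  entry-through-v u∉T y∈T (step {w = w} e r) with any? (λ i → vtx i ≟ᶠ w)
  ... | yes (i , refl) with neighbour i (adj-sym e)
  ...   | inj₁ refl = 0 , z<s , here
  ...   | inj₂ u∈T  = ⊥-elim (u∉T u∈T)
  entry-through-v u∉T y∈T (step e r) | no w∉T with entry-through-v w∉T y∈T r
  ... | j , j<k , r′ = suc j , s≤s j<k , step e r′

  off-thread⇒gated : ∀ {s} → ¬ OnThread G T s → Gated s v top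
  off-thread⇒gated s∉T = entry-through-v s∉T (fromℕ m , refl)

  descend : ∀ i → ∃[ k ] Walk G (Adj-avoiding v) top (vtx i) k
  descend = >-weakInduction _ (0 , here)
    λ i (k , w) → suc k , snoc w (adj-sym (adjs i) , vtx≢v (inject₁ i))

  avoiding-walk-stays : ∀ {a y k} → OnThread G T a → Walk G (Adj-avoiding v) a y k → OnThread G T y
  avoiding-walk-stays a∈T here = a∈T
  avoiding-walk-stays (i , refl) (step (e , b≢v) r) with neighbour i e
  ... | inj₁ b≡v = ⊥-elim (b≢v b≡v)
  ... | inj₂ b∈T = avoiding-walk-stays b∈T r

module BranchResolution (G : Graph) (conn : Connected G) (S : Subset (Graph.n G))
                        (generator : VertexMetricGenerator G S ⊎ EdgeMetricGenerator G S) where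
  open Walks G
  open ThreadStructure G using (top; off-thread⇒gated; descend; avoiding-walk-stays)

  S-free⇒gated : ∀ {v} (3≤deg : 3 ≤ deg G v) (T : Thread G v) → SFree G S T →
                 ∀ {s} → s ∈ S → Gated s v (top 3≤deg T)
  S-free⇒gated 3≤deg T free s∈S =
    off-thread⇒gated 3≤deg T λ (i , vtx≡s) → free i (subst (_∈ S) (sym vtx≡s) s∈S)

  S-free-threads-share-top : ∀ {v} (3≤deg : 3 ≤ deg G v) (T₁ T₂ : Thread G v) →
                             SFree G S T₁ → SFree G S T₂ → top 3≤deg T₁ ≡ top 3≤deg T₂
  S-free-threads-share-top 3≤deg T₁ T₂ free₁ free₂ with top 3≤deg T₁ ≟ᶠ top 3≤deg T₂
  ... | yes same = same
  ... | no differ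
    with generator-escapes-gate conn (adj-sym (Thread.hang T₁)) (adj-sym (Thread.hang T₂)) differ generator
  ...   | s , s∈S , escapes =
    ⊥-elim (escapes (S-free⇒gated 3≤deg T₁ free₁ s∈S , S-free⇒gated 3≤deg T₂ free₂ s∈S))

  same-top⇒⊆ : ∀ {v} (3≤deg : 3 ≤ deg G v) (T₁ T₂ : Thread G v) → top 3≤deg T₁ ≡ top 3≤deg T₂ →
               ∀ {x} → OnThread G T₁ x → OnThread G T₂ x
  same-top⇒⊆ 3≤deg T₁ T₂ same (i , refl) =
    avoiding-walk-stays 3≤deg T₂ (fromℕ (Thread.m T₂) , sym same) (proj₂ (descend 3≤deg T₁ i))

  branch-resolving : BranchResolving G S
  branch-resolving v 3≤deg T₁ T₂ free₁ free₂ x =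
    same-top⇒⊆ 3≤deg T₁ T₂ same , same-top⇒⊆ 3≤deg T₂ T₁ (sym same)
    where same = S-free-threads-share-top 3≤deg T₁ T₂ free₁ free₂

-- Cycles indexed by natural numbers

module CycleNodes (G : Graph) (C : Cycle G) where
  open Walks G
  open Cycle C

  -- Out-of-range indices are sent to vtx zero; all lemmas below are for indices ≤ m.
  node : ℕ → V G
  node k with k <? suc m
  ... | yes k<1+m = vtx (fromℕ< k<1+m)
  ... | no  _     = vtx zero

  node-fromℕ< : ∀ {k} (k<1+m : k < suc m) → node k ≡ vtx (fromℕ< k<1+m)
  node-fromℕ< {k} k<1+m with k <? suc m
  ... | yes _     = refl
  ... | no  k≮1+m = ⊥-elim (k≮1+m k<1+m)

  vtx≡node : ∀ i {k} → toℕ i ≡ k → vtx i ≡ node k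
  vtx≡node i refl = sym (trans (node-fromℕ< (toℕ<n i)) (cong vtx (fromℕ<-toℕ i (toℕ<n i))))

  node-injective : ∀ {a b} → a ≤ m → b ≤ m → node a ≡ node b → a ≡ b
  node-injective {a} {b} a≤m b≤m eq =
    fromℕ<-injective a b (s≤s a≤m) (s≤s b≤m)
      (inj _ _ (trans (sym (node-fromℕ< (s≤s a≤m))) (trans eq (node-fromℕ< (s≤s b≤m)))))

  private
    inject₁-fromℕ<≡node : ∀ {k} (k<m : k < m) → vtx (inject₁ (fromℕ< k<m)) ≡ node k
    inject₁-fromℕ<≡node k<m = vtx≡node _ (trans (toℕ-inject₁ _) (toℕ-fromℕ< k<m))

    suc-fromℕ<≡node : ∀ {k} (k<m : k < m) → vtx (suc (fromℕ< k<m)) ≡ node (suc k)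
    suc-fromℕ<≡node k<m = vtx≡node _ (cong suc (toℕ-fromℕ< k<m))

    fromℕ≡node : vtx (fromℕ m) ≡ node m
    fromℕ≡node = vtx≡node _ (toℕ-fromℕ m)

  node-adj : ∀ {k} → k < m → Adj G (node k) (node (suc k))
  node-adj k<m = subst₂ (Adj G) (inject₁-fromℕ<≡node k<m) (suc-fromℕ<≡node k<m) (adjs (fromℕ< k<m))

  node-adj-closing : Adj G (node m) (node 0)
  node-adj-closing = subst₂ (Adj G) fromℕ≡node (vtx≡node zero refl) close

  node-cycEdge : ∀ {k} → k < m → CycEdge G C (node k) (node (suc k))
  node-cycEdge k<m = inj₁ (fromℕ< k<m , inj₁ (sym (inject₁-fromℕ<≡node k<m) , sym (suc-fromℕ<≡node k<m)))

  cycEdge-sym : ∀ {u w} → CycEdge G C u w → CycEdge G C w u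
  cycEdge-sym (inj₁ (i , same)) = inj₁ (i , sameEdge-swap same)
  cycEdge-sym (inj₂ same)       = inj₂ (sameEdge-swap same)

  cycEdge? : ∀ u w → Dec (CycEdge G C u w)
  cycEdge? u w = any? (λ i → sameEdge? u w (vtx (inject₁ i)) (vtx (suc i)))
            ⊎-dec sameEdge? u w (vtx (fromℕ m)) (vtx zero)

  OnCycle : V G → Set
  OnCycle x = ∃[ r ] (r ≤ m × node r ≡ x)

  vtx-onCycle : ∀ i → OnCycle (vtx i)
  vtx-onCycle i = toℕ i , m<1+n⇒m≤n (toℕ<n i) , sym (vtx≡node i refl)

  onCycle? : ∀ x → Dec (OnCycle x)
  onCycle? x with any? (λ i → vtx i ≟ᶠ x)
  ... | yes (i , refl) = yes (vtx-onCycle i)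
  ... | no  ¬on        = no λ (r , r≤m , node≡x) →
    ¬on (fromℕ< (s≤s r≤m) , trans (sym (node-fromℕ< (s≤s r≤m))) node≡x)

  cycEdge⇒onCycle : ∀ {u w} → CycEdge G C u w → OnCycle u
  cycEdge⇒onCycle (inj₁ (i , same)) = endpoint-onCycle same
    where
    endpoint-onCycle : ∀ {u w a b} → SameEdge G u w (vtx a) (vtx b) → OnCycle u
    endpoint-onCycle (inj₁ (refl , _)) = vtx-onCycle _
    endpoint-onCycle (inj₂ (refl , _)) = vtx-onCycle _
  cycEdge⇒onCycle (inj₂ (inj₁ (refl , _))) = vtx-onCycle _
  cycEdge⇒onCycle (inj₂ (inj₂ (refl , _))) = vtx-onCycle _

  AdjC : V G → V G → Set
  AdjC a b = Adj G a b × CycEdge G C a b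

  AdjC-sym : ∀ {a b} → AdjC a b → AdjC b a
  AdjC-sym (e , ∈C) = adj-sym e , cycEdge-sym ∈C

  node-adjC : ∀ {k} → k < m → AdjC (node k) (node (suc k))
  node-adjC k<m = node-adj k<m , node-cycEdge k<m

  Adj∖C : V G → V G → Set
  Adj∖C a b = Adj G a b × ¬ CycEdge G C a b

  Adj∖C-sym : ∀ {a b} → Adj∖C a b → Adj∖C b a
  Adj∖C-sym (e , ∉C) = adj-sym e , ∉C ∘ cycEdge-sym

-- Paths

module Paths (G : Graph) (E : V G → V G → Set) where

  record Path (u v : V G) : Set where
    field
      len          : ℕ
      at           : ℕ → V G
      at-start     : at 0 ≡ u
      at-end       : at len ≡ v
      at-edge      : ∀ k → k < len → E (at k) (at (suc k))
      at-injective : ∀ i j → i ≤ len → j ≤ len → at i ≡ at j → i ≡ j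

  suffix : ∀ {u v} (P : Path u v) k → k ≤ Path.len P → Path (Path.at P k) v
  suffix P k k≤len = record
    { len          = len ∸ k
    ; at           = λ i → at (k + i)
    ; at-start     = cong at (+-identityʳ k)
    ; at-end       = trans (cong at (m+[n∸m]≡n k≤len)) at-end
    ; at-edge      = λ i i<len∸k → subst (λ z → E (at (k + i)) (at z)) (sym (+-suc k i))
                                      (at-edge (k + i) (subst (_≤ len) (+-suc k i) (shift i<len∸k)))
    ; at-injective = λ i j i≤ j≤ eq →
                       +-cancelˡ-≡ k i j (at-injective (k + i) (k + j) (shift i≤) (shift j≤) eq)
    }
    where
    open Path P
    shift : ∀ {i} → i ≤ len ∸ k → k + i ≤ len
    shift i≤ = subst (k + _ ≤_) (m+[n∸m]≡n k≤len) (+-monoʳ-≤ k i≤)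

  cons : ∀ {u w v} → E u w → (P : Path w v) → (∀ k → k ≤ Path.len P → Path.at P k ≢ u) → Path u v
  cons {u} e P u∉P = record
    { len = suc len ; at = at′ ; at-start = refl ; at-end = at-end
    ; at-edge = at′-edge ; at-injective = at′-injective }
    where
    open Path P
    at′ : ℕ → V G
    at′ zero    = u
    at′ (suc i) = at i
    at′-edge : ∀ i → i < suc len → E (at′ i) (at′ (suc i))
    at′-edge zero    _           = subst (E u) (sym at-start) e
    at′-edge (suc i) (s≤s i<len) = at-edge i i<len
    at′-injective : ∀ i j → i ≤ suc len → j ≤ suc len → at′ i ≡ at′ j → i ≡ j
    at′-injective zero    zero    _        _        _  = refl
    at′-injective zero    (suc j) _        (s≤s j≤) eq = ⊥-elim (u∉P j j≤ (sym eq))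
    at′-injective (suc i) zero    (s≤s i≤) _        eq = ⊥-elim (u∉P i i≤ eq)
    at′-injective (suc i) (suc j) (s≤s i≤) (s≤s j≤) eq = cong suc (at-injective i j i≤ j≤ eq)

  walk⇒path : ∀ {u v k} → Walk G E u v k → Path u v
  walk⇒path {u} here = record
    { len = 0 ; at = λ _ → u ; at-start = refl ; at-end = refl
    ; at-edge = λ _ () ; at-injective = λ { zero zero _ _ _ → refl } }
  walk⇒path {u} (step e r) with walk⇒path r
  ... | P with anyUpTo? (λ k → Path.at P k ≟ᶠ u) (suc (Path.len P))
  ...   | yes (k , k<1+len , at≡u) = subst (λ x → Path x _) at≡u (suffix P k (m<1+n⇒m≤n k<1+len))
  ...   | no  u∉P                  = cons e P λ k k≤len at≡u → u∉P (k , s≤s k≤len , at≡u)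

-- Ears and arcs of a cycle

module EarsAndArcs (G : Graph) (C : Cycle G) where
  open CycleNodes G C
  open Cycle C using (m)
  open Paths G Adj∖C

  record Ear (a b : ℕ) : Set where
    field
      t           : ℕ
      p           : ℕ → V G
      p-start     : p 0 ≡ node a
      p-end       : p (suc t) ≡ node b
      p-edge      : ∀ k → k < suc t → Adj∖C (p k) (p (suc k))
      p-injective : ∀ i j → i ≤ suc t → j ≤ suc t → p i ≡ p j → i ≡ j
      p-interior  : ∀ k → 0 < k → k < suc t → ¬ OnCycle (p k)

  record Arc (a b : ℕ) : Set where
    field
      L           : ℕ
      q           : ℕ → V G
      q-start     : q 0 ≡ node b
      q-end       : q (suc L) ≡ node a
      q-edge      : ∀ r → r < suc L → AdjC (q r) (q (suc r))
      q-injective : ∀ i j → i ≤ suc L → j ≤ suc L → q i ≡ q j → i ≡ j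
      q-on        : ∀ r → r ≤ suc L → OnCycle (q r)

  first-return : ∀ {a b k} → a ≤ m → b ≤ m → a ≢ b → Walk G Adj∖C (node a) (node b) k →
                 ∃[ b′ ] (b′ ≤ m × b′ ≢ a × Ear a b′)
  first-return {a} {b} a≤m b≤m a≢b w =
    ear-at (least-witness returned? len (0<len , b , b≤m , sym at-end))
    where
    open Path (walk⇒path w)

    Returned : ℕ → Set
    Returned k = 0 < k × OnCycle (at k)

    returned? : ∀ k → Dec (Returned k)
    returned? k = (0 <? k) ×-dec onCycle? (at k)

    0<len : 0 < len
    0<len = n≢0⇒n>0 λ len≡0 →
      a≢b (node-injective a≤m b≤m (trans (sym at-start) (trans (cong at (sym len≡0)) at-end)))

    ear-at : ∃[ j ] (Returned j × (∀ i → i < j → ¬ Returned i)) → ∃[ b′ ] (b′ ≤ m × b′ ≢ a × Ear a b′)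
    ear-at (zero , (() , _) , _)
    ear-at (suc t , (_ , b′ , b′≤m , node≡at) , earlier) = b′ , b′≤m , b′≢a , ear
      where
      1+t≤len : suc t ≤ len
      1+t≤len = ≮⇒≥ λ len<1+t → earlier len len<1+t (0<len , b , b≤m , sym at-end)

      b′≢a : b′ ≢ a
      b′≢a refl with at-injective (suc t) 0 1+t≤len z≤n (trans (sym node≡at) (sym at-start))
      ... | ()

      ear : Ear a b′
      ear = record
        { t = t ; p = at ; p-start = at-start ; p-end = sym node≡at
        ; p-edge      = λ k k<1+t → at-edge k (<-≤-trans k<1+t 1+t≤len)
        ; p-injective = λ i j i≤ j≤ → at-injective i j (≤-trans i≤ 1+t≤len) (≤-trans j≤ 1+t≤len)
        ; p-interior  = λ k 0<k k<1+t on → earlier k k<1+t (0<k , on)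
        }

  arc-up : ∀ b L → suc b + L ≤ m → Arc (suc b + L) b
  arc-up b L bound = record
    { L = L ; q = λ r → node (b + r)
    ; q-start     = cong node (+-identityʳ b)
    ; q-end       = cong node (+-suc b L)
    ; q-edge      = λ r r<1+L → subst (λ z → AdjC (node (b + r)) (node z)) (sym (+-suc b r))
                                  (node-adjC (subst (_≤ m) (+-suc b r) (within r<1+L)))
    ; q-injective = λ i j i≤ j≤ eq → +-cancelˡ-≡ b i j (node-injective (within i≤) (within j≤) eq)
    ; q-on        = λ r r≤ → b + r , within r≤ , refl
    }
    where
    within : ∀ {r} → r ≤ suc L → b + r ≤ m
    within r≤ = ≤-trans (+-monoʳ-≤ b r≤) (subst (_≤ m) (sym (+-suc b L)) bound)

  arc-down : ∀ a L → suc a + L ≤ m → Arc a (suc a + L)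
  arc-down a L bound = record
    { L = L ; q = λ r → node (suc a + L ∸ r)
    ; q-start     = refl
    ; q-end       = cong node (m+n∸n≡m a L)
    ; q-edge      = λ r r<1+L → subst (λ z → AdjC (node z) (node (a + L ∸ r)))
                                  (sym (+-∸-assoc 1 (≤-trans (m<1+n⇒m≤n r<1+L) (m≤n+m L a))))
                                  (AdjC-sym (node-adjC (≤-trans (s≤s (m∸n≤m (a + L) r)) bound)))
    ; q-injective = λ i j i≤ j≤ eq →
                      ∸-cancelˡ-≡ (≤-trans i≤ (s≤s (m≤n+m L a))) (≤-trans j≤ (s≤s (m≤n+m L a)))
                                  (node-injective (within i) (within j) eq)
    ; q-on        = λ r _ → suc a + L ∸ r , within r , refl
    }
    where
    within : ∀ r → suc a + L ∸ r ≤ m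
    within r = ≤-trans (m∸n≤m (suc a + L) r) bound

  module Gluing {a b} (P : Ear a b) (A : Arc a b) where
    open Ear P
    open Arc A

    glued : ℕ → V G
    glued k with k ≤? suc t
    ... | yes _ = p k
    ... | no  _ = q (k ∸ suc t)

    glued-ear : ∀ {k} → k ≤ suc t → glued k ≡ p k
    glued-ear {k} k≤ with k ≤? suc t
    ... | yes _  = refl
    ... | no  k≰ = ⊥-elim (k≰ k≤)

    glued-arc : ∀ r → glued (suc t + r) ≡ q r
    glued-arc r with suc t + r ≤? suc t
    glued-arc zero    | yes _  = trans (cong p (+-identityʳ (suc t))) (trans p-end (sym q-start))
    glued-arc (suc r) | yes le = ⊥-elim (<⇒≱ (m<m+n (suc t) z<s) le)
    glued-arc r       | no  _  = cong q (m+n∸m≡n (suc t) r)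

    degenerate⇒⊥ : t ≡ 0 → L ≡ 0 → ⊥
    degenerate⇒⊥ refl refl = proj₂ (p-edge 0 z<s)
      (subst₂ (CycEdge G C) (sym p-start) (sym p-end)
        (cycEdge-sym (subst₂ (CycEdge G C) q-start q-end (proj₂ (q-edge 0 z<s)))))

    nondegenerate : 2 ≤ suc t + L
    nondegenerate with t in t≡ | L in L≡
    ... | suc _ | _     = s≤s (s≤s z≤n)
    ... | zero  | suc _ = s≤s (s≤s z≤n)
    ... | zero  | zero  = ⊥-elim (degenerate⇒⊥ t≡ L≡)

    ear≢arc : ∀ {i r} → i ≤ suc t → 0 < r → r ≤ L → p i ≢ q r
    ear≢arc {i} {r} i≤ 0<r r≤L eq with i ≟ 0 | i ≟ suc t
    ... | yes refl | _        =
      <⇒≢ (s≤s r≤L)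
        (sym (q-injective (suc L) r ≤-refl (m≤n⇒m≤1+n r≤L) (trans q-end (trans (sym p-start) eq))))
    ... | no  _    | yes refl =
      <⇒≢ 0<r (q-injective 0 r z≤n (m≤n⇒m≤1+n r≤L) (trans q-start (trans (sym p-end) eq)))
    ... | no  i≢0  | no  i≢1+t =
      p-interior i (n≢0⇒n>0 i≢0) (≤∧≢⇒< i≤ i≢1+t) (subst OnCycle (sym eq) (q-on r (m≤n⇒m≤1+n r≤L)))

    OnEarOrArc : ℕ → Set
    OnEarOrArc k = (k ≤ suc t × glued k ≡ p k) ⊎ ∃[ r ] (0 < r × k ≡ suc t + r × glued k ≡ q r)

    glued-split : ∀ k → OnEarOrArc k
    glued-split k = by-cases (k ≤? suc t)
      where
      by-cases : Dec (k ≤ suc t) → OnEarOrArc k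
      by-cases (yes k≤) = inj₁ (k≤ , glued-ear k≤)
      by-cases (no  k≰) with m≤n⇒∃[o]m+o≡n (≰⇒> k≰)
      ... | o , refl = inj₂ (suc o , z<s , k≡ , trans (cong glued k≡) (glued-arc (suc o)))
        where
        k≡ : suc (suc t) + o ≡ suc t + suc o
        k≡ = sym (+-suc (suc t) o)

    arc-bound : ∀ {r} → suc t + r ≤ suc t + L → r ≤ L
    arc-bound = +-cancelˡ-≤ (suc t) _ _

    glued-injective : ∀ i j → i ≤ suc t + L → j ≤ suc t + L → glued i ≡ glued j → i ≡ j
    glued-injective i j i≤ j≤ eq with glued-split i | glued-split j
    ... | inj₁ (i≤′ , gi) | inj₁ (j≤′ , gj) = p-injective i j i≤′ j≤′ (trans (sym gi) (trans eq gj))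
    ... | inj₁ (i≤′ , gi) | inj₂ (r , 0<r , refl , gj) =
      ⊥-elim (ear≢arc i≤′ 0<r (arc-bound j≤) (trans (sym gi) (trans eq gj)))
    ... | inj₂ (r , 0<r , refl , gi) | inj₁ (j≤′ , gj) =
      ⊥-elim (ear≢arc j≤′ 0<r (arc-bound i≤) (trans (sym gj) (trans (sym eq) gi)))
    ... | inj₂ (r , _ , refl , gi) | inj₂ (r′ , _ , refl , gj) =
      cong (suc t +_) (q-injective r r′ (m≤n⇒m≤1+n (arc-bound i≤)) (m≤n⇒m≤1+n (arc-bound j≤))
                                    (trans (sym gi) (trans eq gj)))

    glued-adj : ∀ k → k < suc t + L → Adj G (glued k) (glued (suc k))
    glued-adj k k< = by-cases (k <? suc t)
      where
      by-cases : Dec (k < suc t) → Adj G (glued k) (glued (suc k))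
      by-cases (yes k<1+t) =
        subst₂ (Adj G) (sym (glued-ear (<⇒≤ k<1+t))) (sym (glued-ear k<1+t)) (proj₁ (p-edge k k<1+t))
      by-cases (no  k≮1+t) with m≤n⇒∃[o]m+o≡n (≮⇒≥ k≮1+t)
      ... | r , refl = subst₂ (Adj G) (sym (glued-arc r))
                         (sym (trans (cong glued (sym (+-suc (suc t) r))) (glued-arc (suc r))))
                         (proj₁ (q-edge r (m<n⇒m<1+n (+-cancelˡ-≤ (suc t) (suc r) L
                                                          (subst (_≤ suc t + L) (sym (+-suc (suc t) r)) k<)))))

    last-arc-edge : AdjC (glued (toℕ (fromℕ (suc t + L)))) (glued 0)
    last-arc-edge = subst₂ AdjC (trans (sym (glued-arc L)) (cong glued (sym (toℕ-fromℕ (suc t + L)))))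
                                (trans q-end (trans (sym p-start) (sym (glued-ear z≤n))))
                                (q-edge L ≤-refl)

    glued-cycle : Cycle G
    glued-cycle = record
      { m     = suc t + L
      ; long  = nondegenerate
      ; vtx   = λ i → glued (toℕ i)
      ; inj   = λ i j eq → toℕ-injective (glued-injective (toℕ i) (toℕ j) (m<1+n⇒m≤n (toℕ<n i))
                                                           (m<1+n⇒m≤n (toℕ<n j)) eq)
      ; adjs  = λ i → subst (λ z → Adj G (glued z) (glued (suc (toℕ i)))) (sym (toℕ-inject₁ i))
                             (glued-adj (toℕ i) (toℕ<n i))
      ; close = proj₁ last-arc-edge
      }

    -- The closing edge of the glued cycle lies on C, so in a cactus all its edges do,
    -- including the first ear edge.
    ear+arc⇒⊥ : Cactus G → ⊥
    ear+arc⇒⊥ cactus = proj₂ (p-edge 0 z<s)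
      (subst₂ (CycEdge G C) (glued-ear z≤n) (glued-ear (s≤s z≤n)) first-edge-on-C)
      where
      first-edge-on-C : CycEdge G C (glued 0) (glued 1)
      first-edge-on-C = proj₁ (cactus glued-cycle C _ _ (inj₂ (inj₁ (refl , refl))) (proj₂ last-arc-edge) _ _)
                              (inj₁ (zero , inj₁ (refl , refl)))

  Adj∖C-walk⇒≡ : Cactus G → ∀ {a b k} → a ≤ m → b ≤ m → Walk G Adj∖C (node a) (node b) k → a ≡ b
  Adj∖C-walk⇒≡ cactus {a} {b} a≤m b≤m w with a ≟ b
  ... | yes a≡b = a≡b
  ... | no  a≢b with first-return a≤m b≤m a≢b w
  ...   | b′ , b′≤m , b′≢a , ear with <-cmp a b′
  ...     | tri≈ _ a≡b′ _ = ⊥-elim (b′≢a (sym a≡b′))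
  ...     | tri< a<b′ _ _ with m≤n⇒∃[o]m+o≡n a<b′
  ...       | L , refl = ⊥-elim (Gluing.ear+arc⇒⊥ ear (arc-down a L b′≤m) cactus)
  Adj∖C-walk⇒≡ cactus {a} {b} a≤m b≤m w | no a≢b | b′ , b′≤m , b′≢a , ear | tri> _ _ b′<a
    with m≤n⇒∃[o]m+o≡n b′<a
  ... | L , refl = ⊥-elim (Gluing.ear+arc⇒⊥ ear (arc-up b′ L a≤m) cactus)

-- Biactivity

module Biactivity (G : Graph) (conn : Connected G) (cactus : Cactus G) (S : Subset (Graph.n G))
                  (generator : VertexMetricGenerator G S ⊎ EdgeMetricGenerator G S) (C : Cycle G) where
  open Walks G
  open CycleNodes G C
  open EarsAndArcs G C using (Adj∖C-walk⇒≡)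
  open Cycle C using (m; long)

  ActiveAt : ℕ → Set
  ActiveAt r = ∃[ s ] (s ∈ S × ∃[ k ] Walk G Adj∖C (node r) s k)

  reaches-C⇒in-some-T : ∀ {u y k} → OnCycle y → Walk G (Adj G) u y k →
                        ∃[ r ] (r ≤ m × ∃[ k′ ] Walk G Adj∖C u (node r) k′)
  reaches-C⇒in-some-T (r , r≤m , refl) here = r , r≤m , 0 , here
  reaches-C⇒in-some-T {u} y∈C (step {w = w} e rest) with cycEdge? u w
  ... | yes ∈C with cycEdge⇒onCycle ∈C
  ...   | r , r≤m , refl = r , r≤m , 0 , here
  reaches-C⇒in-some-T y∈C (step e rest) | no ∉C with reaches-C⇒in-some-T y∈C rest
  ... | r , r≤m , k′ , w′ = r , r≤m , suc k′ , step (e , ∉C) w′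

  -- A walk can only leave T_c(C) along a cycle edge, whose endpoint in T_c(C) must be node c.
  T-gated : ∀ {c u k₀ r} → c ≤ m → Walk G Adj∖C (node c) u k₀ → r ≤ m → r ≢ c → Gated u (node c) (node r)
  T-gated c≤m w₀ r≤m r≢c here = ⊥-elim (r≢c (sym (Adj∖C-walk⇒≡ cactus c≤m r≤m w₀)))
  T-gated {u = u} c≤m w₀ r≤m r≢c (step {w = w} e rest) with cycEdge? u w
  ... | yes ∈C with cycEdge⇒onCycle ∈C
  ...   | r′ , r′≤m , refl with Adj∖C-walk⇒≡ cactus c≤m r′≤m w₀
  ...     | refl = 0 , z<s , here
  T-gated c≤m w₀ r≤m r≢c (step e rest) | no ∉C with T-gated c≤m (snoc w₀ (e , ∉C)) r≤m r≢c rest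
  ... | j , j<k , w′ = suc j , s≤s j<k , step e w′

  two-neighbours : ∀ {c} → c ≤ m → ∃[ y₁ ] ∃[ y₂ ] (y₁ ≤ m × y₂ ≤ m × node y₁ ≢ node y₂ ×
                                                   Adj G (node c) (node y₁) × Adj G (node c) (node y₂))
  two-neighbours {zero} _ =
    1 , m , 0<m , ≤-refl , (λ eq → <⇒≢ long (node-injective 0<m ≤-refl eq)) ,
    node-adj 0<m , adj-sym node-adj-closing
    where
    0<m : 0 < m
    0<m = ≤-trans (s≤s z≤n) long
  two-neighbours {suc c} 1+c≤m with suc c <? m
  ... | yes 1+c<m =
    c , suc (suc c) , c≤m , 1+c<m , (λ eq → <⇒≢ (m<n⇒m<1+n (n<1+n c)) (node-injective c≤m 1+c<m eq)) ,
    adj-sym (node-adj 1+c≤m) , node-adj 1+c<m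
    where
    c≤m : c ≤ m
    c≤m = ≤-trans (n≤1+n c) 1+c≤m
  ... | no  1+c≮m =
    c , 0 , c≤m , z≤n , (λ eq → c≢0 (node-injective c≤m z≤n eq)) ,
    adj-sym (node-adj 1+c≤m) , subst (λ z → Adj G (node z) (node 0)) (sym 1+c≡m) node-adj-closing
    where
    c≤m : c ≤ m
    c≤m = ≤-trans (n≤1+n c) 1+c≤m
    1+c≡m : suc c ≡ m
    1+c≡m = ≤-antisym 1+c≤m (≮⇒≥ 1+c≮m)
    c≢0 : c ≢ 0
    c≢0 refl = <⇒≢ long 1+c≡m

  active-elsewhere : ∀ {c} → c ≤ m → ∃[ r ] (r ≤ m × r ≢ c × ActiveAt r)
  active-elsewhere {c} c≤m with two-neighbours c≤m
  ... | y₁ , y₂ , y₁≤m , y₂≤m , y₁≢y₂ , e₁ , e₂ with generator-escapes-gate conn e₁ e₂ y₁≢y₂ generator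
  ...   | s , s∈S , escapes with reaches-C⇒in-some-T (0 , z≤n , refl) (proj₂ (conn s (node 0)))
  ...     | r , r≤m , k , w with r ≟ c
  ...       | no  r≢c  = r , r≤m , r≢c , s , s∈S , k , reverse Adj∖C-sym w
  ...       | yes refl = ⊥-elim (escapes (T-gated c≤m w′ y₁≤m (y≢c e₁) , T-gated c≤m w′ y₂≤m (y≢c e₂)))
    where
    w′ = reverse Adj∖C-sym w
    y≢c : ∀ {y} → Adj G (node c) (node y) → y ≢ c
    y≢c e y≡c = adj-irrefl e (cong node (sym y≡c))

  two-active-vertices : ∃[ i ] ∃[ j ] (i ≢ j × Active G S C i × Active G S C j)
  two-active-vertices with active-elsewhere z≤n
  ... | r₁ , r₁≤m , _ , act₁ with active-elsewhere r₁≤m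
  ...   | r₂ , r₂≤m , r₂≢r₁ , act₂ =
    fromℕ< (s≤s r₁≤m) , fromℕ< (s≤s r₂≤m) , (λ eq → r₂≢r₁ (sym (fromℕ<-injective _ _ _ _ eq))) ,
    active r₁≤m act₁ , active r₂≤m act₂
    where
    active : ∀ {r} (r≤m : r ≤ m) → ActiveAt r → Active G S C (fromℕ< (s≤s r≤m))
    active r≤m (s , s∈S , k , w) =
      s , s∈S , k , subst (λ x → Walk G Adj∖C x s k) (node-fromℕ< (s≤s r≤m)) w

lemma1 : (G : Graph) → Connected G → Cactus G → (S : Subset (Graph.n G)) →
         (VertexMetricGenerator G S ⊎ EdgeMetricGenerator G S) →
         Biactive G S × BranchResolving G S
lemma1 G conn cactus S generator =
  Biactivity.two-active-vertices G conn cactus S generator ,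
  BranchResolution.branch-resolving G conn S generator
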